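{- The following set of clauses over the variables $z_1,\dots,z_{15}$ is unsatisfiable: $\{\overline{z_1}, \overline{z_2}\}$, $\{\overline{z_3}, \overline{z_4}\}$, $\{\overline{z_5}, \overline{z_6}\}$, $\{\overline{z_7}, \overline{z_8}\}$, $\{z_7, z_{15}\}$, $\{z_1, z_6, z_8\}$, $\{z_1, z_{11}, z_{12}\}$, $\{z_2, z_{6}, z_{8}\}$, $\{z_2, z_{11}, z_{12}\}$, $\{z_3, z_{5}, z_{9}\}$, $\{z_3, z_{13}, z_{14}\}$, $\{z_4, z_{5}, z_{14}\}$, $\{z_4, z_{9}, z_{10}\}$, $\{z_7, z_{10}, z_{13}\}$, $\{\overline{z_{5}}, \overline{z_{8}}, \overline{z_{15}}\}$, $\{\overline{z_6}, \overline{z_7}, \overline{z_9}\}$, $\{\overline{z_9}, \overline{z_{11}}, \overline{z_{13}}\}$, $\{\overline{z_{10}}, \overline{z_{11}}, \overline{z_{14}}\}$, $\{\overline{z_{10}}, \overline{z_{12}}, \overline{z_{14}}\}$, $\{\overline{z_{12}}, \overline{z_{13}}, \overline{z_{15}}\}$.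
   Context: A clause is a set of literals (variables or negated variables), interpreted as their disjunction; a set of clauses is unsatisfiable if no truth assignment to the variables makes at least one literal true in every clause. -}

module Defs where

open import Data.Nat using (ℕ; _<_)
open import Data.Bool using (Bool; true; false; not)
open import Data.Fin using (Fin; #_)
open import Data.Nat using (_∸_)
open import Relation.Nullary.Decidable using (True)
open import Data.Nat using (_<?_)
open import Data.List using (List; []; _∷_)
open import Data.List.Relation.Unary.All using (All)
open import Data.List.Relation.Unary.Any using (Any)
open import Data.Product using (∃)
open import Relation.Nullary using (¬_)
open import Relation.Binary.PropositionalEquality using (_≡_)

data Literal (n : ℕ) : Set where
  pos : Fin n → Literal n
  neg : Fin n → Literal n

Clause : ℕ → Set
Clause n = List (Literal n)

Assignment : ℕ → Set
Assignment n = Fin n → Bool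

evalLit : ∀ {n} → Assignment n → Literal n → Bool
evalLit α (pos x) = α x
evalLit α (neg x) = not (α x)

SatClause : ∀ {n} → Assignment n → Clause n → Set
SatClause α C = Any (λ l → evalLit α l ≡ true) C

Satisfiable : ∀ {n} → List (Clause n) → Set
Satisfiable {n} Φ = ∃ λ (α : Assignment n) → All (SatClause α) Φ

Unsatisfiable : ∀ {n} → List (Clause n) → Set
Unsatisfiable Φ = ¬ Satisfiable Φ

-- 1-based literals: zp i is z_i, zn i is the negation of z_i (variable index i-1 in Fin 15).
zp : (i : ℕ) → {True ((i ∸ 1) <? 15)} → Literal 15
zp i {p} = pos ((# (i ∸ 1)) {15} {p})

zn : (i : ℕ) → {True ((i ∸ 1) <? 15)} → Literal 15
zn i {p} = neg ((# (i ∸ 1)) {15} {p})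

clauses : List (Clause 15)
clauses =
    (zn 1 ∷ zn 2 ∷ [])
  ∷ (zn 3 ∷ zn 4 ∷ [])
  ∷ (zn 5 ∷ zn 6 ∷ [])
  ∷ (zn 7 ∷ zn 8 ∷ [])
  ∷ (zp 7 ∷ zp 15 ∷ [])
  ∷ (zp 1 ∷ zp 6 ∷ zp 8 ∷ [])
  ∷ (zp 1 ∷ zp 11 ∷ zp 12 ∷ [])
  ∷ (zp 2 ∷ zp 6 ∷ zp 8 ∷ [])
  ∷ (zp 2 ∷ zp 11 ∷ zp 12 ∷ [])
  ∷ (zp 3 ∷ zp 5 ∷ zp 9 ∷ [])
  ∷ (zp 3 ∷ zp 13 ∷ zp 14 ∷ [])
  ∷ (zp 4 ∷ zp 5 ∷ zp 14 ∷ [])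
  ∷ (zp 4 ∷ zp 9 ∷ zp 10 ∷ [])
  ∷ (zp 7 ∷ zp 10 ∷ zp 13 ∷ [])
  ∷ (zn 5 ∷ zn 8 ∷ zn 15 ∷ [])
  ∷ (zn 6 ∷ zn 7 ∷ zn 9 ∷ [])
  ∷ (zn 9 ∷ zn 11 ∷ zn 13 ∷ [])
  ∷ (zn 10 ∷ zn 11 ∷ zn 14 ∷ [])
  ∷ (zn 10 ∷ zn 12 ∷ zn 14 ∷ [])
  ∷ (zn 12 ∷ zn 13 ∷ zn 15 ∷ [])
  ∷ []

-- Idea: Boolean evaluation of a clause set under an assignment is a
-- computable function, and there are only finitely many (2^15)
-- assignments, so unsatisfiability is decided by exhaustive search that
-- the type checker can run.
module Submission where

open import Defs
open import Data.Nat using (zero; suc)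
open import Data.Bool using (Bool; true; false; not; T; _∧_)
open import Data.Bool.ListAction using (any; all)
open import Data.Bool.Properties using (T-∧; T-≡)
open import Data.Vec using (Vec; []; _∷_; lookup; tabulate)
open import Data.Vec.Properties using (lookup∘tabulate)
open import Data.List using (List)
open import Data.List.Relation.Unary.All as All using (All)
open import Data.List.Relation.Unary.All.Properties using (all⁻)
open import Data.List.Relation.Unary.Any as Any using (Any)
open import Data.List.Relation.Unary.Any.Properties using (any⁺)
open import Data.Product using (_,_; proj₁; proj₂)
open import Data.Unit using (tt)
open import Function using (Equivalence)
open import Relation.Nullary using (¬_)
open import Relation.Binary.PropositionalEquality
  using (_≡_; _≗_; refl; sym; trans; cong)

evalClause : ∀ {n} → Assignment n → Clause n → Bool
evalClause α C = any (evalLit α) C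

evalCNF : ∀ {n} → Assignment n → List (Clause n) → Bool
evalCNF α Φ = all (evalClause α) Φ

evalCNF-sound : ∀ {n} (α : Assignment n) (Φ : List (Clause n)) →
                All (SatClause α) Φ → T (evalCNF α Φ)
evalCNF-sound α Φ sat =
  all⁻ (evalClause α) (All.map evalClause-sound sat)
  where
    evalClause-sound : ∀ {C} → SatClause α C → T (evalClause α C)
    evalClause-sound sat-C = any⁺ (evalLit α) (Any.map (Equivalence.from T-≡) sat-C)

evalLit-cong : ∀ {n} {α β : Assignment n} → α ≗ β → ∀ l → evalLit α l ≡ evalLit β l
evalLit-cong α≗β (pos x) = α≗β x
evalLit-cong α≗β (neg x) = cong not (α≗β x)

satisfies-cong : ∀ {n} {α β : Assignment n} → α ≗ β →
                 ∀ {Φ : List (Clause n)} → All (SatClause α) Φ → All (SatClause β) Φ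
satisfies-cong α≗β =
  All.map (Any.map (λ {l} αl≡true → trans (sym (evalLit-cong α≗β l)) αl≡true))

forAllVectors : ∀ n → (Vec Bool n → Bool) → Bool
forAllVectors zero    f = f []
forAllVectors (suc n) f =
  forAllVectors n (λ v → f (true ∷ v)) ∧ forAllVectors n (λ v → f (false ∷ v))

forAllVectors-sound : ∀ n (f : Vec Bool n → Bool) → T (forAllVectors n f) → ∀ v → T (f v)
forAllVectors-sound zero    f holds [] = holds
forAllVectors-sound (suc n) f holds (true ∷ v) =
  forAllVectors-sound n (λ w → f (true ∷ w)) (proj₁ (Equivalence.to T-∧ holds)) v
forAllVectors-sound (suc n) f holds (false ∷ v) =
  forAllVectors-sound n (λ w → f (false ∷ w))
    (proj₂ (Equivalence.to (T-∧ {forAllVectors n (λ w → f (true ∷ w))}) holds)) v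

T-not⇒¬T : ∀ {b} → T (not b) → ¬ T b
T-not⇒¬T {false} _ ()

unsatisfiable-by-search : ∀ {n} (Φ : List (Clause n)) →
                          T (forAllVectors n (λ v → not (evalCNF (lookup v) Φ))) →
                          Unsatisfiable Φ
unsatisfiable-by-search {n} Φ allFalsify (α , sat) =
  T-not⇒¬T (forAllVectors-sound n _ allFalsify v) (evalCNF-sound (lookup v) Φ sat-v)
  where
    v : Vec Bool n
    v = tabulate α

    sat-v : All (SatClause (lookup v)) Φ
    sat-v = satisfies-cong (λ i → sym (lookup∘tabulate α i)) sat

mainTheorem9 : Unsatisfiable clauses
mainTheorem9 = unsatisfiable-by-search clauses tt
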